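{- Suppose $G_1$, $G_2$, $G_3$ are graphs on the same vertex set $Y$ with $|Y|\ge 8$, each of minimum degree at least $2$, such that there is no multicoloured matching, i.e. no three pairwise disjoint edges $e_1,e_2,e_3$ with $e_i\in G_i$ for each $i$. Then there are two vertices $a,b\in Y$ such that every edge of each $G_i$ contains $a$ or $b$. -}

module Defs where

open import Data.Nat using (ℕ)
open import Data.Fin using (Fin)
open import Data.Bool using (Bool; true; false)
open import Data.Product using (Σ; _×_; ∃; ∃-syntax; _,_)
open import Data.Sum using (_⊎_)
open import Relation.Binary.PropositionalEquality using (_≡_; _≢_)
open import Relation.Nullary using (¬_)

record Graph (n : ℕ) : Set where
  field
    adj   : Fin n → Fin n → Bool
    sym   : ∀ x y → adj x y ≡ adj y x
    irrefl : ∀ x → adj x x ≡ false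

open Graph public

Edge : ∀ {n} → Graph n → Fin n → Fin n → Set
Edge G x y = adj G x y ≡ true

MinDeg≥2 : ∀ {n} → Graph n → Set
MinDeg≥2 {n} G = ∀ x → ∃[ y ] ∃[ z ] (y ≢ z × Edge G x y × Edge G x z)

AllDistinct6 : ∀ {n} → Fin n → Fin n → Fin n → Fin n → Fin n → Fin n → Set
AllDistinct6 a b c d e f =
  a ≢ b × a ≢ c × a ≢ d × a ≢ e × a ≢ f ×
  b ≢ c × b ≢ d × b ≢ e × b ≢ f ×
  c ≢ d × c ≢ e × c ≢ f ×
  d ≢ e × d ≢ f ×
  e ≢ f

MulticolouredMatching : ∀ {n} → Graph n → Graph n → Graph n → Set
MulticolouredMatching {n} G₁ G₂ G₃ =
  Σ (Fin n) λ x₁ → Σ (Fin n) λ y₁ → Σ (Fin n) λ x₂ → Σ (Fin n) λ y₂ →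
  Σ (Fin n) λ x₃ → Σ (Fin n) λ y₃ →
    Edge G₁ x₁ y₁ × Edge G₂ x₂ y₂ × Edge G₃ x₃ y₃ ×
    AllDistinct6 x₁ y₁ x₂ y₂ x₃ y₃

CoveredBy : ∀ {n} → Graph n → Fin n → Fin n → Set
CoveredBy {n} G a b = ∀ x y → Edge G x y → (x ≡ a ⊎ x ≡ b ⊎ y ≡ a ⊎ y ≡ b)

-- Fix disjoint edges x₁y₁ ∈ G₁ and x₂y₂ ∈ G₂; since |Y| ≥ 8, four further vertices
-- remain.  An edge among two of them, in any colour, would (using minimum degree 2)
-- complete a multicoloured matching, so three of them, A, B and C, are independent in
-- G₁ ∪ G₂ ∪ G₃.  If p, q are G₁-neighbours of A, a Gⱼ-neighbour of B outside {p, q}, a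
-- Gₖ-neighbour of C and one of Ap, Aq would form a multicoloured matching; bootstrapping,
-- A and B have neighbourhood exactly {p, q} in every colour.  Finally, an edge of Gᵢ
-- missing p and q, together with Ap and Bq in the other two colours, would again be a
-- multicoloured matching.

module Submission where

open import Defs
open import Data.Nat using (ℕ; _≥_; _<_; z≤n; s≤s)
open import Data.Nat.Properties using (≤-trans; n≤1+n; m≤m+n)
open import Data.Fin using (Fin; _≟_)
open import Data.Fin.Properties using (pigeonhole; <⇒≢; ¬∀⟶∃¬)
open import Data.Product using (Σ; _×_; _,_; proj₁; proj₂; ∃-syntax; swap; map₂)
open import Data.Sum using (_⊎_; inj₁; inj₂; [_,_]′)
open import Data.Empty using (⊥; ⊥-elim)
open import Data.List using (List; []; _∷_; length; lookup)
open import Data.List.Relation.Unary.All using (All; []; _∷_)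
open import Data.List.Relation.Unary.All.Properties using (¬Any⇒All¬)
open import Data.List.Relation.Unary.Any using (any?; index)
open import Data.List.Relation.Unary.Any.Properties using (lookup-index)
open import Data.List.Membership.Propositional using (_∈_)
open import Relation.Nullary using (¬_; yes; no)
open import Relation.Binary.PropositionalEquality as ≡ using (_≡_; _≢_; refl; ≢-sym)

module _ {n : ℕ} (G : Graph n) where

  edge-sym : ∀ {x y} → Edge G x y → Edge G y x
  edge-sym {x} {y} xy = ≡.trans (≡.sym (sym G x y)) xy

  edge⇒≢ : ∀ {x y} → Edge G x y → x ≢ y
  edge⇒≢ {x} xy refl with ≡.trans (≡.sym (irrefl G x)) xy
  ... | ()

InPair : ∀ {n} → Fin n → Fin n → Fin n → Set
InPair v a b = v ≡ a ⊎ v ≡ b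

Avoids : ∀ {n} → Fin n → Fin n → Fin n → Set
Avoids v a b = v ≢ a × v ≢ b

in-pair? : ∀ {n} (v a b : Fin n) → InPair v a b ⊎ Avoids v a b
in-pair? v a b with v ≟ a | v ≟ b
... | yes v≡a | _       = inj₁ (inj₁ v≡a)
... | no _    | yes v≡b = inj₁ (inj₂ v≡b)
... | no v≢a  | no v≢b  = inj₂ (v≢a , v≢b)

NeighboursIn : ∀ {n} → Graph n → Fin n → Fin n → Fin n → Set
NeighboursIn G x a b = ∀ {s} → Edge G x s → InPair s a b

module _ {n : ℕ} (G : Graph n) (δ : MinDeg≥2 G) where

  neighbour-≢ : ∀ x s → ∃[ u ] Edge G x u × u ≢ s
  neighbour-≢ x s with δ x
  ... | u , u' , u≢u' , xu , xu' with u ≟ s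
  ...   | yes refl = u' , xu' , ≢-sym u≢u'
  ...   | no u≢s   = u , xu , u≢s

  avoiding-neighbour⊎adjacent-to-both : ∀ x a b →
    (∃[ u ] Edge G x u × Avoids u a b) ⊎ (Edge G x a × Edge G x b)
  avoiding-neighbour⊎adjacent-to-both x a b with δ x
  ... | u , u' , u≢u' , xu , xu' with in-pair? u a b | in-pair? u' a b
  ...   | inj₂ u∉ab          | _                  = inj₁ (u , xu , u∉ab)
  ...   | inj₁ _             | inj₂ u'∉ab         = inj₁ (u' , xu' , u'∉ab)
  ...   | inj₁ (inj₁ refl)   | inj₁ (inj₂ refl)   = inj₂ (xu , xu')
  ...   | inj₁ (inj₂ refl)   | inj₁ (inj₁ refl)   = inj₂ (xu' , xu)
  ...   | inj₁ (inj₁ refl)   | inj₁ (inj₁ refl)   = ⊥-elim (u≢u' refl)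
  ...   | inj₁ (inj₂ refl)   | inj₁ (inj₂ refl)   = ⊥-elim (u≢u' refl)

  adjacent-to-both : ∀ {x a b} → NeighboursIn G x a b → Edge G x a × Edge G x b
  adjacent-to-both {x} {a} {b} N with avoiding-neighbour⊎adjacent-to-both x a b
  ... | inj₁ (u , xu , u≢a , u≢b) = ⊥-elim ([ u≢a , u≢b ]′ (N xu))
  ... | inj₂ both                 = both

neighboursIn⇒≢ : ∀ {n} (G : Graph n) {v a b x y} → NeighboursIn G v a b →
  Edge G x y → Avoids y a b → x ≢ v
neighboursIn⇒≢ G N xy (y≢a , y≢b) refl = [ y≢a , y≢b ]′ (N xy)

fresh : ∀ {n} (L : List (Fin n)) → length L < n → ∃[ x ] All (x ≢_) L
fresh {n} L |L|<n = map₂ (¬Any⇒All¬ L) (¬∀⟶∃¬ n (_∈ L) (λ x → any? (x ≟_) L) ¬all-listed)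
  where
  -- Otherwise the position of each vertex in L would inject Fin n into Fin (length L).
  ¬all-listed : ¬ (∀ x → x ∈ L)
  ¬all-listed x∈L with pigeonhole |L|<n (λ x → index (x∈L x))
  ... | i , j , i<j , same-position = <⇒≢ i<j (begin
    i                          ≡⟨ lookup-index (x∈L i) ⟩
    lookup L (index (x∈L i))   ≡⟨ ≡.cong (lookup L) same-position ⟩
    lookup L (index (x∈L j))   ≡⟨ lookup-index (x∈L j) ⟨
    j                          ∎)
    where open ≡.≡-Reasoning

Disjoint : ∀ {n} → Fin n → Fin n → Fin n → Fin n → Set
Disjoint a b c d = Avoids a c d × Avoids b c d

Disjoint-sym : ∀ {n} {a b c d : Fin n} → Disjoint a b c d → Disjoint c d a b
Disjoint-sym ((a≢c , a≢d) , (b≢c , b≢d)) = (≢-sym a≢c , ≢-sym b≢c) , (≢-sym a≢d , ≢-sym b≢d)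

DisjointEdges : ∀ {n} → Graph n → Graph n → Set
DisjointEdges H H' = ∃[ x ] ∃[ y ] ∃[ x' ] ∃[ y' ] Edge H x y × Edge H' x' y' × Disjoint x y x' y'

disjoint-edges : ∀ {n} {H H' : Graph n} → n ≥ 4 → MinDeg≥2 H → MinDeg≥2 H' → DisjointEdges H H'
disjoint-edges {H = H} {H'} n≥4 δ δ' with fresh [] (≤-trans (s≤s z≤n) n≥4)
... | v , [] with δ v
...   | _ , _ , _ , vs , _ = from-edge vs
  where
  from-edge : ∀ {x y} → Edge H x y → DisjointEdges H H'
  from-edge {x} {y} xy with fresh (x ∷ y ∷ []) (≤-trans (n≤1+n 3) n≥4)
  ... | w , w≢x ∷ w≢y ∷ [] with avoiding-neighbour⊎adjacent-to-both H' δ' w x y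
  ...   | inj₁ (t , wt , t≢x , t≢y) =
          x , y , w , t , xy , wt , (≢-sym w≢x , ≢-sym t≢x) , (≢-sym w≢y , ≢-sym t≢y)
  ...   | inj₂ (wx , wy) with fresh (x ∷ y ∷ w ∷ []) n≥4
  ...     | u , u≢x ∷ u≢y ∷ u≢w ∷ [] with avoiding-neighbour⊎adjacent-to-both H δ u x w
  ...       | inj₁ (t , ut , t≢x , t≢w) = u , t , w , x , ut , wx , (u≢w , u≢x) , (t≢w , t≢x)
  ...       | inj₂ (ux , _)             =
              u , x , w , y , ux , wy , (u≢w , u≢y) , (≢-sym w≢x , edge⇒≢ H xy)

record NoRainbow {n} (H₁ H₂ H₃ : Graph n) : Set where
  constructor no-rainbow
  field
    ¬rainbow : ∀ {a b c d e f : Fin n} →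
      Edge H₁ a b → Edge H₂ c d → Edge H₃ e f →
      Disjoint a b c d → Disjoint a b e f → Disjoint c d e f → ⊥

open NoRainbow public

¬MulticolouredMatching⇒NoRainbow : ∀ {n} {G₁ G₂ G₃ : Graph n} →
  ¬ MulticolouredMatching G₁ G₂ G₃ → NoRainbow G₁ G₂ G₃
¬MulticolouredMatching⇒NoRainbow {G₁ = G₁} {G₂} {G₃} ¬M = no-rainbow λ {a} {b} {c} {d} {e} {f} ab cd ef
  ((a≢c , a≢d) , (b≢c , b≢d)) ((a≢e , a≢f) , (b≢e , b≢f)) ((c≢e , c≢f) , (d≢e , d≢f)) →
  ¬M (a , b , c , d , e , f , ab , cd , ef ,
      edge⇒≢ G₁ ab , a≢c , a≢d , a≢e , a≢f , b≢c , b≢d , b≢e , b≢f ,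
      edge⇒≢ G₂ cd , c≢e , c≢f , d≢e , d≢f , edge⇒≢ G₃ ef)

NoRainbow-swap₁₂ : ∀ {n} {H₁ H₂ H₃ : Graph n} → NoRainbow H₁ H₂ H₃ → NoRainbow H₂ H₁ H₃
NoRainbow-swap₁₂ nr = no-rainbow λ ab cd ef d₁₂ d₁₃ d₂₃ → ¬rainbow nr cd ab ef (Disjoint-sym d₁₂) d₂₃ d₁₃

NoRainbow-swap₂₃ : ∀ {n} {H₁ H₂ H₃ : Graph n} → NoRainbow H₁ H₂ H₃ → NoRainbow H₁ H₃ H₂
NoRainbow-swap₂₃ nr = no-rainbow λ ab cd ef d₁₂ d₁₃ d₂₃ → ¬rainbow nr ab ef cd d₁₃ d₁₂ (Disjoint-sym d₂₃)

Outside : ∀ {n} → Fin n → Fin n → Fin n → Fin n → Fin n → Set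
Outside x₁ y₁ x₂ y₂ v = Avoids v x₁ y₁ × Avoids v x₂ y₂

module _ {n : ℕ} {H₁ H₂ H₃ : Graph n} (nr : NoRainbow H₁ H₂ H₃) {x₁ y₁ x₂ y₂ : Fin n} where

  ¬H₃-edge-outside : ∀ {a b} → Edge H₁ x₁ y₁ → Edge H₂ x₂ y₂ → Disjoint x₁ y₁ x₂ y₂ →
    Outside x₁ y₁ x₂ y₂ a → Outside x₁ y₁ x₂ y₂ b → ¬ Edge H₃ a b
  ¬H₃-edge-outside x₁y₁ x₂y₂ e₁∩e₂=∅ (a∉e₁ , a∉e₂) (b∉e₁ , b∉e₂) ab =
    ¬rainbow nr x₁y₁ x₂y₂ ab e₁∩e₂=∅ (Disjoint-sym (a∉e₁ , b∉e₁)) (Disjoint-sym (a∉e₂ , b∉e₂))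

  -- Every H₃-edge at z or z' must land in e₂, so z and z' see both ends of x₂y₂ in H₃;
  -- using them, every H₂-neighbour of y₁ must be r or r'.  Then an H₁-neighbour s ≠ y₁
  -- of x₁ completes a rainbow matching whatever s is.
  ¬H₁-edge-outside : MinDeg≥2 H₁ → MinDeg≥2 H₂ → MinDeg≥2 H₃ → ∀ {r r' z z'} →
    Edge H₁ x₁ y₁ → Edge H₂ x₂ y₂ → Disjoint x₁ y₁ x₂ y₂ →
    Outside x₁ y₁ x₂ y₂ r → Outside x₁ y₁ x₂ y₂ r' →
    Outside x₁ y₁ x₂ y₂ z → Outside x₁ y₁ x₂ y₂ z' →
    r ≢ z → r ≢ z' → r' ≢ z → r' ≢ z' → z ≢ z' → ¬ Edge H₁ r r'
  ¬H₁-edge-outside δ₁ δ₂ δ₃ {r} {r'} {z} {z'} x₁y₁ x₂y₂ e₁∩e₂=∅@((x₁≢x₂ , x₁≢y₂) , (y₁≢x₂ , y₁≢y₂))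
    or@((r≢x₁ , r≢y₁) , r∉e₂@(r≢x₂ , r≢y₂)) or'@((r'≢x₁ , r'≢y₁) , r'∉e₂@(r'≢x₂ , r'≢y₂))
    oz@((z≢x₁ , z≢y₁) , (z≢x₂ , z≢y₂)) oz'@((z'≢x₁ , z'≢y₁) , (z'≢x₂ , z'≢y₂))
    r≢z r≢z' r'≢z r'≢z' z≢z' rr' = x₁-lacks-second-neighbour
    where
    x₁≢y₁ : x₁ ≢ y₁
    x₁≢y₁ = edge⇒≢ H₁ x₁y₁

    H₃-neighbours-in-e₂ : ∀ {Z} → Outside x₁ y₁ x₂ y₂ Z → Z ≢ r → Z ≢ r' → NeighboursIn H₃ Z x₂ y₂
    H₃-neighbours-in-e₂ {Z} oZ@(_ , Z∉e₂) Z≢r Z≢r' {u} Zu with in-pair? u x₂ y₂ | in-pair? u r r'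
    ... | inj₁ u∈e₂ | _                = u∈e₂
    ... | inj₂ _    | inj₁ (inj₁ refl) = ⊥-elim (¬H₃-edge-outside x₁y₁ x₂y₂ e₁∩e₂=∅ oZ or Zu)
    ... | inj₂ _    | inj₁ (inj₂ refl) = ⊥-elim (¬H₃-edge-outside x₁y₁ x₂y₂ e₁∩e₂=∅ oZ or' Zu)
    ... | inj₂ u∉e₂ | inj₂ u∉rr'       = ⊥-elim (¬rainbow nr rr' x₂y₂ Zu
          (r∉e₂ , r'∉e₂)
          (Disjoint-sym ((Z≢r , Z≢r') , u∉rr'))
          (Disjoint-sym (Z∉e₂ , u∉e₂)))

    z-to-e₂ : Edge H₃ z x₂ × Edge H₃ z y₂
    z-to-e₂ = adjacent-to-both H₃ δ₃ (H₃-neighbours-in-e₂ oz (≢-sym r≢z) (≢-sym r'≢z))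

    z'-to-e₂ : Edge H₃ z' x₂ × Edge H₃ z' y₂
    z'-to-e₂ = adjacent-to-both H₃ δ₃ (H₃-neighbours-in-e₂ oz' (≢-sym r≢z') (≢-sym r'≢z'))

    H₂-neighbours-of-y₁ : NeighboursIn H₂ y₁ r r'
    H₂-neighbours-of-y₁ {w} y₁w with in-pair? w r r'
    ... | inj₁ w∈rr' = w∈rr'
    ... | inj₂ (w≢r , w≢r') with in-pair? w z x₂
    ...   | inj₁ (inj₁ refl) = ⊥-elim (¬rainbow nr rr' y₁w (proj₁ z'-to-e₂)
            ((r≢y₁ , r≢z) , (r'≢y₁ , r'≢z))
            ((r≢z' , r≢x₂) , (r'≢z' , r'≢x₂))
            ((≢-sym z'≢y₁ , y₁≢x₂) , (z≢z' , z≢x₂)))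
    ...   | inj₁ (inj₂ refl) = ⊥-elim (¬rainbow nr rr' y₁w (proj₂ z-to-e₂)
            ((r≢y₁ , r≢x₂) , (r'≢y₁ , r'≢x₂))
            ((r≢z , r≢y₂) , (r'≢z , r'≢y₂))
            ((≢-sym z≢y₁ , y₁≢y₂) , (≢-sym z≢x₂ , edge⇒≢ H₂ x₂y₂)))
    ...   | inj₂ (w≢z , w≢x₂) = ⊥-elim (¬rainbow nr rr' y₁w (proj₁ z-to-e₂)
            ((r≢y₁ , ≢-sym w≢r) , (r'≢y₁ , ≢-sym w≢r'))
            ((r≢z , r≢x₂) , (r'≢z , r'≢x₂))
            ((≢-sym z≢y₁ , y₁≢x₂) , (w≢z , w≢x₂)))

    y₁-to-rr' : Edge H₂ y₁ r × Edge H₂ y₁ r'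
    y₁-to-rr' = adjacent-to-both H₂ δ₂ H₂-neighbours-of-y₁

    x₁-lacks-second-neighbour : ⊥
    x₁-lacks-second-neighbour with neighbour-≢ H₁ δ₁ x₁ y₁
    ... | s , x₁s , s≢y₁ with in-pair? s z r
    ...   | inj₁ (inj₁ refl) = ¬rainbow nr x₁s (proj₁ y₁-to-rr') (proj₁ z'-to-e₂)
            ((x₁≢y₁ , ≢-sym r≢x₁) , (s≢y₁ , ≢-sym r≢z))
            ((≢-sym z'≢x₁ , x₁≢x₂) , (z≢z' , z≢x₂))
            ((≢-sym z'≢y₁ , y₁≢x₂) , (r≢z' , r≢x₂))
    ...   | inj₁ (inj₂ refl) = ¬rainbow nr x₁s (proj₂ y₁-to-rr') (proj₂ z-to-e₂)
            ((x₁≢y₁ , ≢-sym r'≢x₁) , (s≢y₁ , edge⇒≢ H₁ rr'))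
            ((≢-sym z≢x₁ , x₁≢y₂) , (r≢z , r≢y₂))
            ((≢-sym z≢y₁ , y₁≢y₂) , (r'≢z , r'≢y₂))
    ...   | inj₂ (s≢z , s≢r) with s ≟ x₂
    ...     | yes refl = ¬rainbow nr x₁s (proj₂ y₁-to-rr') (proj₂ z-to-e₂)
              ((x₁≢y₁ , ≢-sym r'≢x₁) , (s≢y₁ , ≢-sym r'≢x₂))
              ((≢-sym z≢x₁ , x₁≢y₂) , (≢-sym z≢x₂ , edge⇒≢ H₂ x₂y₂))
              ((≢-sym z≢y₁ , y₁≢y₂) , (r'≢z , r'≢y₂))
    ...     | no s≢x₂ = ¬rainbow nr x₁s (proj₁ y₁-to-rr') (proj₁ z-to-e₂)
              ((x₁≢y₁ , ≢-sym r≢x₁) , (s≢y₁ , s≢r))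
              ((≢-sym z≢x₁ , x₁≢x₂) , (s≢z , s≢x₂))
              ((≢-sym z≢y₁ , y₁≢x₂) , (r≢z , r≢x₂))

Independent : ∀ {n} {I : Set} → (I → Graph n) → Fin n → Fin n → Set
Independent G x y = x ≢ y × (∀ i → ¬ Edge (G i) x y)

module _ {n : ℕ} {I : Set} (G : I → Graph n) where

  independent-sym : ∀ {x y} → Independent G x y → Independent G y x
  independent-sym (x≢y , ¬xy) = ≢-sym x≢y , λ i yx → ¬xy i (edge-sym (G i) yx)

  independent⇒neighbour-≢ : ∀ i {x y u} → Independent G x y → Edge (G i) x u → u ≢ y
  independent⇒neighbour-≢ i (_ , ¬xy) xu refl = ¬xy i xu

  module _ (i j k : I) (nr : NoRainbow (G i) (G j) (G k)) {A B C : Fin n}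
           (AB : Independent G A B) (AC : Independent G A C) (BC : Independent G B C) where

    ¬rainbow-star : ∀ {t s u} → Edge (G i) A t → Edge (G j) B s → Edge (G k) C u →
      t ≢ s → t ≢ u → s ≢ u → ⊥
    ¬rainbow-star At Bs Cu t≢s t≢u s≢u = ¬rainbow nr At Bs Cu
      ((proj₁ AB , ≢-sym (independent⇒neighbour-≢ j (independent-sym AB) Bs)) ,
       (independent⇒neighbour-≢ i AB At , t≢s))
      ((proj₁ AC , ≢-sym (independent⇒neighbour-≢ k (independent-sym AC) Cu)) ,
       (independent⇒neighbour-≢ i AC At , t≢u))
      ((proj₁ BC , ≢-sym (independent⇒neighbour-≢ k (independent-sym BC) Cu)) ,
       (independent⇒neighbour-≢ j BC Bs , s≢u))

    neighbours-transfer : MinDeg≥2 (G k) → ∀ {p q} → Edge (G i) A p × Edge (G i) A q → p ≢ q →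
      NeighboursIn (G j) B p q
    neighbours-transfer δₖ {p} {q} (Ap , Aq) p≢q {s} Bs with in-pair? s p q
    ... | inj₁ s∈pq = s∈pq
    ... | inj₂ (s≢p , s≢q) with neighbour-≢ (G k) δₖ C s
    ...   | u , Cu , u≢s with p ≟ u
    ...     | yes refl = ⊥-elim (¬rainbow-star Aq Bs Cu (≢-sym s≢q) (≢-sym p≢q) (≢-sym u≢s))
    ...     | no p≢u   = ⊥-elim (¬rainbow-star Ap Bs Cu (≢-sym s≢p) p≢u (≢-sym u≢s))

covered-by-common-neighbours : ∀ {n} {H₁ H₂ H₃ : Graph n} → NoRainbow H₁ H₂ H₃ →
  ∀ {w w' p q} → w ≢ w' → p ≢ q →
  NeighboursIn H₁ w p q → NeighboursIn H₁ w' p q →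
  Edge H₂ w p × Edge H₂ w q → Edge H₃ w' p × Edge H₃ w' q → CoveredBy H₁ p q
covered-by-common-neighbours {H₁ = H₁} {H₂} {H₃} nr {p = p} {q} w≢w' p≢q Nw Nw'
  (wp , wq) (w'p , w'q) x y xy
  with in-pair? x p q | in-pair? y p q
... | inj₁ (inj₁ x≡p) | _               = inj₁ x≡p
... | inj₁ (inj₂ x≡q) | _               = inj₂ (inj₁ x≡q)
... | inj₂ _          | inj₁ (inj₁ y≡p) = inj₂ (inj₂ (inj₁ y≡p))
... | inj₂ _          | inj₁ (inj₂ y≡q) = inj₂ (inj₂ (inj₂ y≡q))
... | inj₂ x∉pq@(x≢p , x≢q) | inj₂ y∉pq@(y≢p , y≢q) = ⊥-elim (¬rainbow nr xy wp w'q
      ((x≢ Nw , x≢p) , (y≢ Nw , y≢p))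
      ((x≢ Nw' , x≢q) , (y≢ Nw' , y≢q))
      ((w≢w' , edge⇒≢ H₂ wq) , (≢-sym (edge⇒≢ H₃ w'p) , p≢q)))
  where
  x≢ : ∀ {v} → NeighboursIn H₁ v p q → x ≢ v
  x≢ Nv = neighboursIn⇒≢ H₁ Nv xy y∉pq

  y≢ : ∀ {v} → NeighboursIn H₁ v p q → y ≢ v
  y≢ Nv = neighboursIn⇒≢ H₁ Nv (edge-sym H₁ xy) x∉pq

data Colour : Set where
  c₁ c₂ c₃ : Colour

module _ {n : ℕ} {G₁ G₂ G₃ : Graph n} (δ₁ : MinDeg≥2 G₁) (δ₂ : MinDeg≥2 G₂) (δ₃ : MinDeg≥2 G₃)
         (nr : NoRainbow G₁ G₂ G₃) where

  G : Colour → Graph n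
  G c₁ = G₁
  G c₂ = G₂
  G c₃ = G₃

  nr₁₃₂ : NoRainbow G₁ G₃ G₂
  nr₁₃₂ = NoRainbow-swap₂₃ nr

  nr₂₁₃ : NoRainbow G₂ G₁ G₃
  nr₂₁₃ = NoRainbow-swap₁₂ nr

  nr₂₃₁ : NoRainbow G₂ G₃ G₁
  nr₂₃₁ = NoRainbow-swap₂₃ nr₂₁₃

  nr₃₁₂ : NoRainbow G₃ G₁ G₂
  nr₃₁₂ = NoRainbow-swap₁₂ nr₁₃₂

  nr₃₂₁ : NoRainbow G₃ G₂ G₁
  nr₃₂₁ = NoRainbow-swap₂₃ nr₃₁₂

  outside-independent : ∀ {x₁ y₁ x₂ y₂ r r' z z'} →
    Edge G₁ x₁ y₁ → Edge G₂ x₂ y₂ → Disjoint x₁ y₁ x₂ y₂ →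
    Outside x₁ y₁ x₂ y₂ r → Outside x₁ y₁ x₂ y₂ r' →
    Outside x₁ y₁ x₂ y₂ z → Outside x₁ y₁ x₂ y₂ z' →
    r ≢ r' → r ≢ z → r ≢ z' → r' ≢ z → r' ≢ z' → z ≢ z' → Independent G r r'
  outside-independent e₁ e₂ e₁∩e₂=∅ or or' oz oz' r≢r' r≢z r≢z' r'≢z r'≢z' z≢z' = r≢r' , λ where
    c₁ → ¬H₁-edge-outside nr δ₁ δ₂ δ₃ e₁ e₂ e₁∩e₂=∅ or or' oz oz' r≢z r≢z' r'≢z r'≢z' z≢z'
    c₂ → ¬H₁-edge-outside nr₂₁₃ δ₂ δ₁ δ₃ e₂ e₁ (Disjoint-sym e₁∩e₂=∅)
           (swap or) (swap or') (swap oz) (swap oz') r≢z r≢z' r'≢z r'≢z' z≢z'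
    c₃ → ¬H₃-edge-outside nr e₁ e₂ e₁∩e₂=∅ or or'

  independent-triple : n ≥ 8 → ∀ {x₁ y₁ x₂ y₂} →
    Edge G₁ x₁ y₁ → Edge G₂ x₂ y₂ → Disjoint x₁ y₁ x₂ y₂ →
    ∃[ A ] ∃[ B ] ∃[ C ] Independent G A B × Independent G A C × Independent G B C
  independent-triple n≥8 {x₁} {y₁} {x₂} {y₂} e₁ e₂ e₁∩e₂=∅
    with fresh (x₁ ∷ y₁ ∷ x₂ ∷ y₂ ∷ []) (≤-trans (m≤m+n 5 3) n≥8)
  ... | r₁ , o₁
    with fresh (r₁ ∷ x₁ ∷ y₁ ∷ x₂ ∷ y₂ ∷ []) (≤-trans (m≤m+n 6 2) n≥8)
  ... | r₂ , r₂≢r₁ ∷ o₂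
    with fresh (r₂ ∷ r₁ ∷ x₁ ∷ y₁ ∷ x₂ ∷ y₂ ∷ []) (≤-trans (m≤m+n 7 1) n≥8)
  ... | r₃ , r₃≢r₂ ∷ r₃≢r₁ ∷ o₃
    with fresh (r₃ ∷ r₂ ∷ r₁ ∷ x₁ ∷ y₁ ∷ x₂ ∷ y₂ ∷ []) n≥8
  ... | r₄ , r₄≢r₃ ∷ r₄≢r₂ ∷ r₄≢r₁ ∷ o₄ =
    r₁ , r₂ , r₃ ,
    outside-independent e₁ e₂ e₁∩e₂=∅ (outside o₁) (outside o₂) (outside o₃) (outside o₄)
      (≢-sym r₂≢r₁) (≢-sym r₃≢r₁) (≢-sym r₄≢r₁) (≢-sym r₃≢r₂) (≢-sym r₄≢r₂) (≢-sym r₄≢r₃) ,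
    outside-independent e₁ e₂ e₁∩e₂=∅ (outside o₁) (outside o₃) (outside o₂) (outside o₄)
      (≢-sym r₃≢r₁) (≢-sym r₂≢r₁) (≢-sym r₄≢r₁) r₃≢r₂ (≢-sym r₄≢r₃) (≢-sym r₄≢r₂) ,
    outside-independent e₁ e₂ e₁∩e₂=∅ (outside o₂) (outside o₃) (outside o₁) (outside o₄)
      (≢-sym r₃≢r₂) r₂≢r₁ (≢-sym r₄≢r₂) r₃≢r₁ (≢-sym r₄≢r₃) (≢-sym r₄≢r₁)
    where
    outside : ∀ {v} → All (v ≢_) (x₁ ∷ y₁ ∷ x₂ ∷ y₂ ∷ []) → Outside x₁ y₁ x₂ y₂ v
    outside (v≢x₁ ∷ v≢y₁ ∷ v≢x₂ ∷ v≢y₂ ∷ []) = (v≢x₁ , v≢y₁) , (v≢x₂ , v≢y₂)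

  -- Starting from two G₁-neighbours p, q of A, neighbours-transfer confines the
  -- neighbourhoods of B and then of A to {p, q} in every colour; C only serves as the
  -- third independent vertex that each transfer needs.
  common-neighbour-pair : ∀ {A B C} →
    Independent G A B → Independent G A C → Independent G B C →
    Σ (Fin n) λ p → Σ (Fin n) λ q →
      p ≢ q × CoveredBy G₁ p q × CoveredBy G₂ p q × CoveredBy G₃ p q
  common-neighbour-pair {A} {B} AB AC BC with δ₁ A
  ... | p , q , p≢q , Ap , Aq =
    p , q , p≢q ,
    covered-by-common-neighbours nr    A≢B p≢q A₁ B₁ A-to-pq₂ B-to-pq₃ ,
    covered-by-common-neighbours nr₂₁₃ A≢B p≢q A₂ B₂ A-to-pq₁ B-to-pq₃ ,
    covered-by-common-neighbours nr₃₁₂ A≢B p≢q A₃ B₃ A-to-pq₁ B-to-pq₂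
    where
    A≢B : A ≢ B
    A≢B = proj₁ AB

    BA : Independent G B A
    BA = independent-sym G AB

    A-to-pq₁ : Edge G₁ A p × Edge G₁ A q
    A-to-pq₁ = Ap , Aq

    B₂ : NeighboursIn G₂ B p q
    B₂ = neighbours-transfer G c₁ c₂ c₃ nr AB AC BC δ₃ A-to-pq₁ p≢q

    B₃ : NeighboursIn G₃ B p q
    B₃ = neighbours-transfer G c₁ c₃ c₂ nr₁₃₂ AB AC BC δ₂ A-to-pq₁ p≢q

    B-to-pq₂ : Edge G₂ B p × Edge G₂ B q
    B-to-pq₂ = adjacent-to-both G₂ δ₂ B₂

    B-to-pq₃ : Edge G₃ B p × Edge G₃ B q
    B-to-pq₃ = adjacent-to-both G₃ δ₃ B₃

    A₁ : NeighboursIn G₁ A p q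
    A₁ = neighbours-transfer G c₂ c₁ c₃ nr₂₁₃ BA BC AC δ₃ B-to-pq₂ p≢q

    A₂ : NeighboursIn G₂ A p q
    A₂ = neighbours-transfer G c₃ c₂ c₁ nr₃₂₁ BA BC AC δ₁ B-to-pq₃ p≢q

    A₃ : NeighboursIn G₃ A p q
    A₃ = neighbours-transfer G c₂ c₃ c₁ nr₂₃₁ BA BC AC δ₁ B-to-pq₂ p≢q

    A-to-pq₂ : Edge G₂ A p × Edge G₂ A q
    A-to-pq₂ = adjacent-to-both G₂ δ₂ A₂

    B₁ : NeighboursIn G₁ B p q
    B₁ = neighbours-transfer G c₂ c₁ c₃ nr₂₁₃ AB AC BC δ₃ A-to-pq₂ p≢q

lemma6p5 : (n : ℕ) → n ≥ 8 → (G₁ G₂ G₃ : Graph n) →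
    MinDeg≥2 G₁ → MinDeg≥2 G₂ → MinDeg≥2 G₃ →
    ¬ MulticolouredMatching G₁ G₂ G₃ →
    Σ (Fin n) λ a → Σ (Fin n) λ b →
      a ≢ b × CoveredBy G₁ a b × CoveredBy G₂ a b × CoveredBy G₃ a b
lemma6p5 n n≥8 G₁ G₂ G₃ δ₁ δ₂ δ₃ ¬M =
  let nr : NoRainbow G₁ G₂ G₃
      nr = ¬MulticolouredMatching⇒NoRainbow ¬M
      (x₁ , y₁ , x₂ , y₂ , e₁ , e₂ , e₁∩e₂=∅) =
        disjoint-edges {H = G₁} {H' = G₂} (≤-trans (m≤m+n 4 4) n≥8) δ₁ δ₂
      (A , B , C , AB , AC , BC) = independent-triple δ₁ δ₂ δ₃ nr n≥8 e₁ e₂ e₁∩e₂=∅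
  in common-neighbour-pair δ₁ δ₂ δ₃ nr AB AC BC
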